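{- The sequence $$\Big((-1)^{s_4(x)}\Big(S_{5,0}(x)-10S_{5,0}\big(\lfloor x/16\rfloor\big)+5S_{5,0}\big(\lfloor x/256\rfloor\big)\Big)\Big)_{x\ge 0}$$ is periodic with period $2560$.
   Context: For an integer $b\ge 2$ and integer $r\ge 0$, $s_b(r)$ denotes the sum of the digits of $r$ in base $b$. For integers $x\ge 0$, define $$S_{5,0}(x)=\sum_{0\le r<x,\; r\equiv 0 \pmod 5}(-1)^{s_{4}(r)}.$$ -}

module Defs where

open import Data.Nat using (ℕ; zero; suc; _+_; _*_; _≡ᵇ_)
open import Data.Nat.DivMod using (_/_; _%_)
open import Data.Bool using (if_then_else_)
open import Data.Integer using (ℤ; +_; -_; 1ℤ)
import Data.Integer as ℤ

-- digit sum of r in base (2 + b'), i.e. base b = b' + 2 ≥ 2.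
-- The fuel argument bounds the number of digits; fuel r suffices.
digitSumAux : ℕ → ℕ → ℕ → ℕ
digitSumAux b' zero    r = 0
digitSumAux b' (suc f) zero = 0
digitSumAux b' (suc f) r@(suc _) = r % (2 + b') + digitSumAux b' f (r / (2 + b'))

digitSum : ℕ → ℕ → ℕ
digitSum b' r = digitSumAux b' r r

s₄ : ℕ → ℕ
s₄ = digitSum 2

sgn : ℕ → ℤ
sgn zero = 1ℤ
sgn (suc n) = - sgn n

S50 : ℕ → ℤ
S50 zero = + 0
S50 (suc x) = (if x % 5 ≡ᵇ 0 then sgn (s₄ x) else + 0) ℤ.+ S50 x

a : ℕ → ℤ
a x = sgn (s₄ x) ℤ.* (S50 x ℤ.- (+ 10) ℤ.* S50 (x / 16) ℤ.+ (+ 5) ℤ.* S50 (x / 256))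

module Submission where

-- * Digit sums are additive across blocks of base-b digits, so τ(r + k·4ʲ) = τ(r)·τ(k)
--   for r < 4ʲ; this makes τ "locally determined" modulo powers of 4.
-- * Moving from x to x+1 changes S(⌊x/n⌋) only when x ≡ n-1 (mod n), which gives
--   a(x+1) = E(x)·(a(x) + h(x)) with E(x) = τ(x)τ(x+1) and h(x) = τ(x)·(G(x+1) - G(x)).
-- * h is 2560-periodic (it depends on x only through residues modulo 5·16 and 5·256), and
--   E(x) = E(x mod 512) unless x ≡ 511 (mod 512); at those exceptional points a finite
--   computation shows that a(x+1) = 0 and a(x+1 mod 2560) = 0.
-- * An abstract lemma turns these three facts into periodicity of any sequence obeying such
--   a recurrence; the main theorem follows.

open import Defs
open import Data.Nat using (ℕ; zero; suc; _+_; _*_; _^_; _≤_; _<_; s≤s; z≤n; NonZero; _≡ᵇ_)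
import Data.Nat as ℕ
import Data.Nat.Properties as ℕP
open import Data.Nat.DivMod
open import Data.Nat.Divisibility using (_∣_; divides)
open import Data.Nat.Solver using (module +-*-Solver)
open import Data.Integer using (ℤ; +_; -_; 0ℤ; 1ℤ)
import Data.Integer as ℤ
import Data.Integer.Properties as ℤP
import Data.Integer.Solver as ℤSolver
open import Data.Bool using (true; false; if_then_else_; T)
open import Data.Unit using (tt)
open import Data.Empty using (⊥-elim)
open import Data.Product using (_×_; _,_)
open import Data.Sum using (_⊎_; inj₁; inj₂)
open import Relation.Nullary using (¬_; Dec; yes; no)
open import Relation.Nullary.Decidable using (from-yes; _⊎-dec_)
open import Relation.Binary.PropositionalEquality

suc-/-base : ∀ b' r → suc r / (2 + b') ≤ r
suc-/-base b' r = ℕP.≤-pred (m/n<m (suc r) (2 + b') (s≤s (s≤s z≤n)))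

digitSumAux-fuel : ∀ b' f g r → r ≤ f → r ≤ g → digitSumAux b' f r ≡ digitSumAux b' g r
digitSumAux-fuel b' zero    zero    zero    _ _ = refl
digitSumAux-fuel b' zero    (suc g) zero    _ _ = refl
digitSumAux-fuel b' (suc f) zero    zero    _ _ = refl
digitSumAux-fuel b' (suc f) (suc g) zero    _ _ = refl
digitSumAux-fuel b' (suc f) (suc g) (suc r) (s≤s r≤f) (s≤s r≤g) =
  cong (λ s → suc r % (2 + b') + s)
       (digitSumAux-fuel b' f g (suc r / (2 + b')) (ℕP.≤-trans (suc-/-base b' r) r≤f)
                                                      (ℕP.≤-trans (suc-/-base b' r) r≤g))

digitSum-step : ∀ b' m → digitSum b' m ≡ m % (2 + b') + digitSum b' (m / (2 + b'))
digitSum-step b' zero    = refl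
digitSum-step b' (suc r) =
  cong (λ s → suc r % (2 + b') + s) (digitSumAux-fuel b' r q q (suc-/-base b' r) ℕP.≤-refl)
  where q = suc r / (2 + b')

digitSum-push : ∀ b' d q → d < 2 + b' → digitSum b' (d + q * (2 + b')) ≡ d + digitSum b' q
digitSum-push b' d q d<b = begin
  digitSum b' n                        ≡⟨ digitSum-step b' n ⟩
  n % (2 + b') + digitSum b' (n / (2 + b'))
    ≡⟨ cong₂ (λ u v → u + digitSum b' v) ([m+kn]%n≡m%n d q (2 + b')) (+-distrib-/-∣ʳ d (divides q refl)) ⟩
  d % (2 + b') + digitSum b' (d / (2 + b') + q * (2 + b') / (2 + b'))
    ≡⟨ cong₂ (λ u v → u + digitSum b' v) (m<n⇒m%n≡m d<b) (cong₂ _+_ (m<n⇒m/n≡0 d<b) (m*n/n≡m q (2 + b'))) ⟩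
  d + digitSum b' q ∎
  where
  open ≡-Reasoning
  n = d + q * (2 + b')

digitSum-split : ∀ b' j r k → r < (2 + b') ^ j →
                 digitSum b' (r + k * (2 + b') ^ j) ≡ digitSum b' r + digitSum b' k
digitSum-split b' zero    zero    k _ = cong (digitSum b') (ℕP.*-identityʳ k)
digitSum-split b' zero    (suc r) k (s≤s ())
digitSum-split b' (suc j) r    k r<bn = begin
  digitSum b' (r + k * (b * n))           ≡⟨ cong (digitSum b') regroup ⟩
  digitSum b' (r₀ + (r₁ + k * n) * b)     ≡⟨ digitSum-push b' r₀ (r₁ + k * n) (m%n<n r b) ⟩
  r₀ + digitSum b' (r₁ + k * n)           ≡⟨ cong (λ s → r₀ + s) (digitSum-split b' j r₁ k r₁<n) ⟩
  r₀ + (digitSum b' r₁ + digitSum b' k)   ≡⟨ ℕP.+-assoc r₀ _ _ ⟨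
  r₀ + digitSum b' r₁ + digitSum b' k     ≡⟨ cong (_+ digitSum b' k) (digitSum-push b' r₀ r₁ (m%n<n r b)) ⟨
  digitSum b' (r₀ + r₁ * b) + digitSum b' k ≡⟨ cong (λ m → digitSum b' m + digitSum b' k) (m≡m%n+[m/n]*n r b) ⟨
  digitSum b' r + digitSum b' k ∎
  where
  open ≡-Reasoning
  b = 2 + b'
  n = b ^ j
  r₀ = r % b
  r₁ = r / b
  r₁<n : r₁ < n
  r₁<n = m<n*o⇒m/o<n (subst (r <_) (ℕP.*-comm b n) r<bn)
  regroup : r + k * (b * n) ≡ r₀ + (r₁ + k * n) * b
  regroup = begin
    r + k * (b * n)              ≡⟨ cong (_+ k * (b * n)) (m≡m%n+[m/n]*n r b) ⟩
    r₀ + r₁ * b + k * (b * n)    ≡⟨ solve 5 (λ r₀ r₁ k b n → r₀ :+ r₁ :* b :+ k :* (b :* n) := r₀ :+ (r₁ :+ k :* n) :* b) refl r₀ r₁ k b n ⟩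
    r₀ + (r₁ + k * n) * b ∎
    where open +-*-Solver

sgn-+ : ∀ m n → sgn (m + n) ≡ sgn m ℤ.* sgn n
sgn-+ zero    n = sym (ℤP.*-identityˡ (sgn n))
sgn-+ (suc m) n = trans (cong -_ (sgn-+ m n)) (ℤP.neg-distribˡ-* (sgn m) (sgn n))

sgn-square : ∀ n → sgn n ℤ.* sgn n ≡ 1ℤ
sgn-square zero    = refl
sgn-square (suc n) = trans (solve 1 (λ s → (:- s) :* (:- s) := s :* s) refl (sgn n)) (sgn-square n)
  where open ℤSolver.+-*-Solver

τ : ℕ → ℤ
τ x = sgn (s₄ x)

τ-square : ∀ x → τ x ℤ.* τ x ≡ 1ℤ
τ-square x = sgn-square (s₄ x)

BlockMultiplicative : ℕ → Set
BlockMultiplicative n = ∀ r k → r < n → τ (r + k * n) ≡ τ r ℤ.* τ k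

τ-block : ∀ j → BlockMultiplicative (4 ^ j)
τ-block j r k r<n = trans (cong sgn (digitSum-split 2 j r k r<n)) (sgn-+ (s₄ r) (s₄ k))

τ-split : ∀ n .{{_ : NonZero n}} → BlockMultiplicative n → ∀ x → τ x ≡ τ (x % n) ℤ.* τ (x / n)
τ-split n block x = trans (cong τ (m≡m%n+[m/n]*n x n)) (block (x % n) (x / n) (m%n<n x n))

summand : ℕ → ℤ
summand x = if x % 5 ≡ᵇ 0 then τ x else + 0

-- Increment of S50(⌊x/n⌋) when x steps to x+1 (with n = m+1): nonzero only if x ≡ m (mod n).
floorIncrement : ℕ → ℕ → ℤ
floorIncrement m x = if x % suc m ≡ᵇ m then summand (x / suc m) else + 0

suc-/-carry : ∀ m x → x % suc m ≡ m → suc x / suc m ≡ suc (x / suc m)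
suc-/-carry m x x%n≡m = begin
  suc x / suc m                             ≡⟨ cong (λ y → suc y / suc m) (m≡m%n+[m/n]*n x (suc m)) ⟩
  suc (x % suc m + x / suc m * suc m) / suc m ≡⟨ cong (λ r → suc (r + x / suc m * suc m) / suc m) x%n≡m ⟩
  suc (x / suc m) * suc m / suc m           ≡⟨ m*n/n≡m (suc (x / suc m)) (suc m) ⟩
  suc (x / suc m) ∎
  where open ≡-Reasoning

suc-/-noCarry : ∀ m x → ¬ (x % suc m ≡ m) → suc x / suc m ≡ x / suc m
suc-/-noCarry m x x%n≢m = begin
  suc x / suc m                                    ≡⟨ cong (λ y → suc y / suc m) (m≡m%n+[m/n]*n x (suc m)) ⟩
  (suc (x % suc m) + x / suc m * suc m) / suc m    ≡⟨ +-distrib-/-∣ʳ (suc (x % suc m)) (divides (x / suc m) refl) ⟩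
  suc (x % suc m) / suc m + x / suc m * suc m / suc m
    ≡⟨ cong₂ _+_ (m<n⇒m/n≡0 r+1<n) (m*n/n≡m (x / suc m) (suc m)) ⟩
  x / suc m ∎
  where
  open ≡-Reasoning
  r+1<n : suc (x % suc m) < suc m
  r+1<n = s≤s (ℕP.≤∧≢⇒< (ℕP.≤-pred (m%n<n x (suc m))) x%n≢m)

S50-floor-step : ∀ m x → S50 (suc x / suc m) ≡ floorIncrement m x ℤ.+ S50 (x / suc m)
S50-floor-step m x with x % suc m ≡ᵇ m in eq
... | true  rewrite suc-/-carry m x (ℕP.≡ᵇ⇒≡ _ _ (subst T (sym eq) tt)) = refl
... | false rewrite suc-/-noCarry m x (λ e → subst T eq (ℕP.≡⇒≡ᵇ _ _ e)) = sym (ℤP.+-identityˡ _)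

G : ℕ → ℤ
G x = S50 x ℤ.- (+ 10) ℤ.* S50 (x / 16) ℤ.+ (+ 5) ℤ.* S50 (x / 256)

Δ : ℕ → ℤ
Δ x = summand x ℤ.- (+ 10) ℤ.* floorIncrement 15 x ℤ.+ (+ 5) ℤ.* floorIncrement 255 x

G-step : ∀ x → G (suc x) ≡ G x ℤ.+ Δ x
G-step x rewrite S50-floor-step 15 x | S50-floor-step 255 x =
  solve 6 (λ c s d s₁₆ e s₂₅₆ →
      (c :+ s) :- con (+ 10) :* (d :+ s₁₆) :+ con (+ 5) :* (e :+ s₂₅₆)
      := (s :- con (+ 10) :* s₁₆ :+ con (+ 5) :* s₂₅₆) :+ (c :- con (+ 10) :* d :+ con (+ 5) :* e))
    refl (summand x) (S50 x) (floorIncrement 15 x) (S50 (x / 16)) (floorIncrement 255 x) (S50 (x / 256))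
  where open ℤSolver.+-*-Solver

-- Multiplier and inhomogeneity of the first-order recurrence satisfied by a.
E : ℕ → ℤ
E x = τ x ℤ.* τ (suc x)

h : ℕ → ℤ
h x = τ x ℤ.* Δ x

-- a (x+1) = E x · (a x + h x), using τ(x)² = 1.
a-step : ∀ x → a (suc x) ≡ E x ℤ.* (a x ℤ.+ h x)
a-step x = begin
  τ (suc x) ℤ.* G (suc x)                         ≡⟨ cong (τ (suc x) ℤ.*_) (G-step x) ⟩
  τ (suc x) ℤ.* (G x ℤ.+ Δ x)                     ≡⟨ cong (ℤ._* (G x ℤ.+ Δ x)) (ℤP.*-identityʳ (τ (suc x))) ⟨
  τ (suc x) ℤ.* 1ℤ ℤ.* (G x ℤ.+ Δ x)              ≡⟨ cong (λ o → τ (suc x) ℤ.* o ℤ.* (G x ℤ.+ Δ x)) (τ-square x) ⟨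
  τ (suc x) ℤ.* (τ x ℤ.* τ x) ℤ.* (G x ℤ.+ Δ x)
    ≡⟨ solve 4 (λ t₁ t₀ g d → t₁ :* (t₀ :* t₀) :* (g :+ d) := t₀ :* t₁ :* (t₀ :* g :+ t₀ :* d)) refl (τ (suc x)) (τ x) (G x) (Δ x) ⟩
  E x ℤ.* (a x ℤ.+ h x) ∎
  where
  open ≡-Reasoning
  open ℤSolver.+-*-Solver

suc-%-residue : ∀ P .{{_ : NonZero P}} x → suc x % P ≡ suc (x % P) % P
suc-%-residue P x =
  trans (cong (λ y → suc y % P) (m≡m%n+[m/n]*n x P)) ([m+kn]%n≡m%n (suc (x % P)) (x / P) P)

periodic-by-recurrence :
  ∀ P .{{_ : NonZero P}} (u E h : ℕ → ℤ) →
  (∀ x → u (suc x) ≡ E x ℤ.* (u x ℤ.+ h x)) →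
  (∀ x → h x ≡ h (x % P)) →
  (∀ x → let y = x % P in
         (suc y < P × E x ≡ E y) ⊎ (u y ℤ.+ h y ≡ 0ℤ × u (suc y % P) ≡ 0ℤ)) →
  ∀ x → u x ≡ u (x % P)
periodic-by-recurrence P u E h step h-periodic regular-or-reset = go
  where
  go : ∀ x → u x ≡ u (x % P)
  go zero    = cong u (sym (m<n⇒m%n≡m (ℕ.>-nonZero⁻¹ P)))
  go (suc x) with regular-or-reset x
  ... | inj₁ (y+1<P , Ex≡Ey) = begin
    u (suc x)                   ≡⟨ step x ⟩
    E x ℤ.* (u x ℤ.+ h x)       ≡⟨ cong₂ (λ e v → e ℤ.* (v ℤ.+ h x)) Ex≡Ey (go x) ⟩
    E y ℤ.* (u y ℤ.+ h x)       ≡⟨ cong (λ v → E y ℤ.* (u y ℤ.+ v)) (h-periodic x) ⟩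
    E y ℤ.* (u y ℤ.+ h y)       ≡⟨ step y ⟨
    u (suc y)                   ≡⟨ cong u (m<n⇒m%n≡m y+1<P) ⟨
    u (suc y % P)               ≡⟨ cong u (suc-%-residue P x) ⟨
    u (suc x % P) ∎
    where
    open ≡-Reasoning
    y = x % P
  ... | inj₂ (uy+hy≡0 , u[y+1]≡0) = begin
    u (suc x)                   ≡⟨ step x ⟩
    E x ℤ.* (u x ℤ.+ h x)       ≡⟨ cong₂ (λ v w → E x ℤ.* (v ℤ.+ w)) (go x) (h-periodic x) ⟩
    E x ℤ.* (u y ℤ.+ h y)       ≡⟨ cong (E x ℤ.*_) uy+hy≡0 ⟩
    E x ℤ.* 0ℤ                  ≡⟨ ℤP.*-zeroʳ (E x) ⟩
    0ℤ                          ≡⟨ u[y+1]≡0 ⟨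
    u (suc y % P)               ≡⟨ cong u (suc-%-residue P x) ⟨
    u (suc x % P) ∎
    where
    open ≡-Reasoning
    y = x % P

isZero : ℕ → ℤ
isZero n = if n ≡ᵇ 0 then 1ℤ else + 0

-- τ x · floorIncrement m x, written through the residue r = x mod n and the digit
-- c = ⌊x/n⌋ mod 5 only (n = m+1).
boundaryTerm : ℕ → ℕ → ℕ → ℤ
boundaryTerm m r c = if r ≡ᵇ m then (if c ≡ᵇ 0 then τ r else + 0) else + 0

τ-summand : ∀ x → τ x ℤ.* summand x ≡ isZero (x % 5)
τ-summand x with x % 5 ≡ᵇ 0
... | true  = τ-square x
... | false = ℤP.*-zeroʳ (τ x)

-- At a block boundary n = m+1 the factor τ(⌊x/n⌋) cancels against τ x.
τ-floorIncrement : ∀ m → BlockMultiplicative (suc m) →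
                   ∀ x → τ x ℤ.* floorIncrement m x ≡ boundaryTerm m (x % suc m) (x / suc m % 5)
τ-floorIncrement m block x with x % suc m ≡ᵇ m
... | false = ℤP.*-zeroʳ (τ x)
... | true with x / suc m % 5 ≡ᵇ 0
...   | false = ℤP.*-zeroʳ (τ x)
...   | true  = begin
  τ x ℤ.* τ q                 ≡⟨ cong (ℤ._* τ q) (τ-split (suc m) block x) ⟩
  τ r ℤ.* τ q ℤ.* τ q         ≡⟨ ℤP.*-assoc (τ r) (τ q) (τ q) ⟩
  τ r ℤ.* (τ q ℤ.* τ q)       ≡⟨ cong (τ r ℤ.*_) (τ-square q) ⟩
  τ r ℤ.* 1ℤ                  ≡⟨ ℤP.*-identityʳ (τ r) ⟩
  τ r ∎
  where
  open ≡-Reasoning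
  q = x / suc m
  r = x % suc m

hOfResidues : ℕ → ℕ → ℕ → ℕ → ℕ → ℤ
hOfResidues r₅ r₁₆ c₁₆ r₂₅₆ c₂₅₆ =
  isZero r₅ ℤ.- (+ 10) ℤ.* boundaryTerm 15 r₁₆ c₁₆ ℤ.+ (+ 5) ℤ.* boundaryTerm 255 r₂₅₆ c₂₅₆

h-residues : ∀ x → h x ≡ hOfResidues (x % 5) (x % 16) (x / 16 % 5) (x % 256) (x / 256 % 5)
h-residues x = begin
  τ x ℤ.* Δ x
    ≡⟨ solve 4 (λ t c d e → t :* (c :- con (+ 10) :* d :+ con (+ 5) :* e)
                         := t :* c :- con (+ 10) :* (t :* d) :+ con (+ 5) :* (t :* e))
             refl (τ x) (summand x) (floorIncrement 15 x) (floorIncrement 255 x) ⟩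
  τ x ℤ.* summand x ℤ.- (+ 10) ℤ.* (τ x ℤ.* floorIncrement 15 x) ℤ.+ (+ 5) ℤ.* (τ x ℤ.* floorIncrement 255 x)
    ≡⟨ cong₂ (λ u v → u ℤ.- (+ 10) ℤ.* v ℤ.+ (+ 5) ℤ.* (τ x ℤ.* floorIncrement 255 x))
             (τ-summand x) (τ-floorIncrement 15 (τ-block 2) x) ⟩
  isZero (x % 5) ℤ.- (+ 10) ℤ.* boundaryTerm 15 (x % 16) (x / 16 % 5) ℤ.+ (+ 5) ℤ.* (τ x ℤ.* floorIncrement 255 x)
    ≡⟨ cong (λ w → isZero (x % 5) ℤ.- (+ 10) ℤ.* boundaryTerm 15 (x % 16) (x / 16 % 5) ℤ.+ (+ 5) ℤ.* w)
            (τ-floorIncrement 255 (τ-block 4) x) ⟩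
  hOfResidues (x % 5) (x % 16) (x / 16 % 5) (x % 256) (x / 256 % 5) ∎
  where
  open ≡-Reasoning
  open ℤSolver.+-*-Solver

digit-mod : ∀ d n P x .{{_ : NonZero d}} .{{_ : NonZero n}} .{{_ : NonZero P}} {{_ : NonZero (d * n)}} →
            d * n ∣ P → x / n % d ≡ x % P / n % d
digit-mod d n P x dn∣P = begin
  x / n % d                  ≡⟨ m%[n*o]/o≡m/o%n x d n ⟨
  x % (d * n) / n            ≡⟨ cong (_/ n) (m∣n⇒o%n%m≡o%m (d * n) P x dn∣P) ⟨
  x % P % (d * n) / n        ≡⟨ m%[n*o]/o≡m/o%n (x % P) d n ⟩
  x % P / n % d ∎
  where open ≡-Reasoning

-- h is 2560-periodic: all residues it depends on are determined by x mod 2560.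
h-periodic : ∀ x → h x ≡ h (x % 2560)
h-periodic x = begin
  h x                          ≡⟨ h-residues x ⟩
  hOfResidues (x % 5) (x % 16) (x / 16 % 5) (x % 256) (x / 256 % 5)
    ≡⟨ cong₂ (λ u v → hOfResidues u v (x / 16 % 5) (x % 256) (x / 256 % 5)) (mod 5 512 refl) (mod 16 160 refl) ⟩
  hOfResidues (y % 5) (y % 16) (x / 16 % 5) (x % 256) (x / 256 % 5)
    ≡⟨ cong₂ (λ u v → hOfResidues (y % 5) (y % 16) u v (x / 256 % 5))
             (digit-mod 5 16 2560 x (divides 32 refl)) (mod 256 10 refl) ⟩
  hOfResidues (y % 5) (y % 16) (y / 16 % 5) (y % 256) (x / 256 % 5)
    ≡⟨ cong (hOfResidues (y % 5) (y % 16) (y / 16 % 5) (y % 256)) (digit-mod 5 256 2560 x (divides 2 refl)) ⟩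
  hOfResidues (y % 5) (y % 16) (y / 16 % 5) (y % 256) (y / 256 % 5) ≡⟨ h-residues y ⟨
  h y ∎
  where
  open ≡-Reasoning
  y = x % 2560
  mod : ∀ m k .{{_ : NonZero m}} → k * m ≡ 2560 → x % m ≡ y % m
  mod m k k*m≡P = sym (m∣n⇒o%n%m≡o%m m 2560 x (divides k (sym k*m≡P)))

E-split : ∀ n .{{_ : NonZero n}} → BlockMultiplicative n → ∀ x → suc (x % n) < n → E x ≡ E (x % n)
E-split n block x r+1<n = begin
  τ x ℤ.* τ (suc x)                   ≡⟨ cong₂ ℤ._*_ (τ-split n block x) τ[x+1] ⟩
  τ r ℤ.* τ q ℤ.* (τ (suc r) ℤ.* τ q)
    ≡⟨ solve 3 (λ a b c → a :* b :* (c :* b) := a :* c :* (b :* b)) refl (τ r) (τ q) (τ (suc r)) ⟩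
  τ r ℤ.* τ (suc r) ℤ.* (τ q ℤ.* τ q) ≡⟨ cong (τ r ℤ.* τ (suc r) ℤ.*_) (τ-square q) ⟩
  τ r ℤ.* τ (suc r) ℤ.* 1ℤ            ≡⟨ ℤP.*-identityʳ _ ⟩
  τ r ℤ.* τ (suc r) ∎
  where
  open ≡-Reasoning
  open ℤSolver.+-*-Solver
  r = x % n
  q = x / n
  τ[x+1] : τ (suc x) ≡ τ (suc r) ℤ.* τ q
  τ[x+1] = trans (cong (λ y → τ (suc y)) (m≡m%n+[m/n]*n x n)) (block (suc r) q r+1<n)

E-512-below-1024 : ∀ {w} → w < 1024 → w % 512 ≡ 511 ⊎ E w ≡ E (w % 512)
E-512-below-1024 = from-yes (ℕP.allUpTo? (λ w → (w % 512 ℕ.≟ 511) ⊎-dec (E w ℤP.≟ E (w % 512))) 1024)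

-- E x = E (x mod 512) unless x ≡ 511 (mod 512): reduce modulo 1024 = 4⁵, then check.
E-almost-periodic : ∀ x → ¬ (x % 512 ≡ 511) → E x ≡ E (x % 512)
E-almost-periodic x x≢511 = conclude (E-512-below-1024 (m%n<n x 1024))
  where
  w = x % 1024
  w%512≡x%512 : w % 512 ≡ x % 512
  w%512≡x%512 = m∣n⇒o%n%m≡o%m 512 1024 x (divides 2 refl)
  w+1<1024 : suc w < 1024
  w+1<1024 = s≤s (ℕP.≤∧≢⇒< (ℕP.≤-pred (m%n<n x 1024))
                          (λ w≡1023 → x≢511 (trans (sym w%512≡x%512) (cong (_% 512) w≡1023))))
  conclude : w % 512 ≡ 511 ⊎ E w ≡ E (w % 512) → E x ≡ E (x % 512)
  conclude (inj₁ w%512≡511) = ⊥-elim (x≢511 (trans (sym w%512≡x%512) w%512≡511))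
  conclude (inj₂ Ew≡E[w%512]) =
    trans (E-split 1024 (τ-block 5) x w+1<1024) (trans Ew≡E[w%512] (cong E w%512≡x%512))

reset-points : ∀ q → q < 5 → let y = 511 + q * 512 in
               a y ℤ.+ h y ≡ 0ℤ × a (suc y % 2560) ≡ 0ℤ
reset-points 0 _ = refl , refl
reset-points 1 _ = refl , refl
reset-points 2 _ = refl , refl
reset-points 3 _ = refl , refl
reset-points 4 _ = refl , refl
reset-points (suc (suc (suc (suc (suc q))))) (s≤s (s≤s (s≤s (s≤s (s≤s ())))))

regular-or-reset : ∀ x → let y = x % 2560 in
                   (suc y < 2560 × E x ≡ E y) ⊎ (a y ℤ.+ h y ≡ 0ℤ × a (suc y % 2560) ≡ 0ℤ)
regular-or-reset x = classify (x % 512 ℕ.≟ 511)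
  where
  y = x % 2560
  y%512≡x%512 : y % 512 ≡ x % 512
  y%512≡x%512 = m∣n⇒o%n%m≡o%m 512 2560 x (divides 5 refl)
  classify : Dec (x % 512 ≡ 511) →
             (suc y < 2560 × E x ≡ E y) ⊎ (a y ℤ.+ h y ≡ 0ℤ × a (suc y % 2560) ≡ 0ℤ)
  classify (no x≢511) = inj₁ (y+1<2560 , Ex≡Ey)
    where
    y≢511 : ¬ (y % 512 ≡ 511)
    y≢511 e = x≢511 (trans (sym y%512≡x%512) e)
    Ex≡Ey : E x ≡ E y
    Ex≡Ey = trans (E-almost-periodic x x≢511)
                  (trans (cong E (sym y%512≡x%512)) (sym (E-almost-periodic y y≢511)))
    y+1<2560 : suc y < 2560
    y+1<2560 = ℕP.≤∧≢⇒< (m%n<n x 2560) (λ y+1≡2560 → y≢511 (cong (_% 512) (ℕP.suc-injective y+1≡2560)))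
  classify (yes x≡511) =
    inj₂ (subst (λ z → a z ℤ.+ h z ≡ 0ℤ × a (suc z % 2560) ≡ 0ℤ) (sym y≡511+512q) (reset-points q q<5))
    where
    q = y / 512
    y≡511+512q : y ≡ 511 + q * 512
    y≡511+512q = trans (m≡m%n+[m/n]*n y 512) (cong (_+ q * 512) (trans y%512≡x%512 x≡511))
    q<5 : q < 5
    q<5 = m<n*o⇒m/o<n (m%n<n x 2560)

mainTheorem13 : ∀ (x : ℕ) → a (x + 2560) ≡ a x
mainTheorem13 x = begin
  a (x + 2560)            ≡⟨ a-periodic (x + 2560) ⟩
  a ((x + 2560) % 2560)   ≡⟨ cong a ([m+n]%n≡m%n x 2560) ⟩
  a (x % 2560)            ≡⟨ a-periodic x ⟨
  a x ∎
  where
  open ≡-Reasoning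
  a-periodic : ∀ x → a x ≡ a (x % 2560)
  a-periodic = periodic-by-recurrence 2560 a E h a-step h-periodic regular-or-reset
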